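{- Fix an integer $k\ge 2$. There are a constant $c>0$ and an integer $n_0$ (depending on $k$) such that for every $n\ge n_0$ there is a graph $G_n$ on $n$ vertices such that every $k$-CNF formula that encodes the independent-set property of $G_n$ has at least $c\,n^2/\log_2 n$ clauses.
   Context: A $k$-CNF formula is a CNF formula in which every clause has at most $k$ literals; its size is its number of clauses. For a formula $F$ and an assignment $\tau$ to some of its variables, $F|_\tau$ is obtained by deleting every clause satisfied by $\tau$ and deleting from the remaining clauses every literal falsified by $\tau$. Given a graph $G=(V,E)$, variables $X=\{x_v : v\in V\}$ and a (possibly empty) set $Y$ of auxiliary variables, a formula $F$ with variable set $X\cup Y$ encodes the independent-set property of $G$ if for every assignment $\tau: X\to\{\bot,\top\}$, $F|_\tau$ is satisfiable if and only if $\{v\in V : \tau(x_v)=\top\}$ is an independent set of $G$. -}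

module Defs where

open import Data.Nat using (ℕ; _≤_)
open import Data.Fin using (Fin)
open import Data.Bool using (Bool; true; false; not; if_then_else_; _∨_)
open import Data.Sum using (_⊎_; inj₁; inj₂)
open import Data.Product using (_×_; _,_; Σ)
open import Data.List using (List; []; _∷_; length)
open import Data.List.Relation.Unary.All using (All)
open import Data.List.Relation.Unary.Any using (Any)
open import Relation.Binary.PropositionalEquality using (_≡_)

record Graph (n : ℕ) : Set where
  field
    Adj   : Fin n → Fin n → Bool
    sym   : ∀ u v → Adj u v ≡ Adj v u
    irrefl : ∀ v → Adj v v ≡ false

open Graph public

-- A literal over variable type V: a variable with a polarity (true = positive).
Literal : Set → Set
Literal V = V × Bool

Clause : Set → Set
Clause V = List (Literal V)

CNF : Set → Set
CNF V = List (Clause V)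

-- Variables of an encoding: X = {x_v : v ∈ Fin n} (inj₁) and auxiliary Y = Fin m (inj₂).
EncVar : ℕ → ℕ → Set
EncVar n m = Fin n ⊎ Fin m

size : {V : Set} → CNF V → ℕ
size F = length F

IsKCNF : {V : Set} → ℕ → CNF V → Set
IsKCNF k F = All (λ C → length C ≤ k) F

litVal : {V : Set} → (V → Bool) → Literal V → Bool
litVal α (v , b) = if b then α v else not (α v)

Satisfies : {V : Set} → (V → Bool) → CNF V → Set
Satisfies α F = All (λ C → Any (λ l → litVal α l ≡ true) C) F

Satisfiable : {V : Set} → CNF V → Set
Satisfiable {V} F = Σ (V → Bool) (λ α → Satisfies α F)

clauseSatX : {n m : ℕ} → (Fin n → Bool) → Clause (EncVar n m) → Bool
clauseSatX τ [] = false
clauseSatX τ ((inj₁ x , b) ∷ C) = litVal τ (x , b) ∨ clauseSatX τ C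
clauseSatX τ ((inj₂ y , b) ∷ C) = clauseSatX τ C

dropX : {n m : ℕ} → Clause (EncVar n m) → Clause (Fin m)
dropX [] = []
dropX ((inj₁ x , b) ∷ C) = dropX C
dropX ((inj₂ y , b) ∷ C) = (y , b) ∷ dropX C

-- F|τ : delete satisfied clauses, delete falsified literals from the rest.
restrict : {n m : ℕ} → (Fin n → Bool) → CNF (EncVar n m) → CNF (Fin m)
restrict τ [] = []
restrict τ (C ∷ F) = if clauseSatX τ C then restrict τ F else (dropX C ∷ restrict τ F)

IsIndependent : {n : ℕ} → Graph n → (Fin n → Bool) → Set
IsIndependent G τ = ∀ u v → τ u ≡ true → τ v ≡ true → Adj G u v ≡ false

Encodes : {n m : ℕ} → Graph n → CNF (EncVar n m) → Set
Encodes G F = ∀ τ → (Satisfiable (restrict τ F) → IsIndependent G τ)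
                  × (IsIndependent G τ → Satisfiable (restrict τ F))

{-# OPTIONS --safe #-}

-- Counting argument. An encoding F of G determines G: u and v are adjacent iff
-- F restricted to the indicator of {u, v} is unsatisfiable. A k-CNF with at most S
-- clauses mentions at most kS auxiliary variables, so after renaming them it lies in
-- a fixed list of at most (1 + (1 + 2(n + kS + 1))^k)^S formulas. For S = n² / (c log n)
-- this is less than the number 2^(⌊n/2⌋⌈n/2⌉) of bipartite graphs between the two
-- halves of the vertex set, so one of them has no k-CNF encoding with S clauses.

module Submission where

open import Defs hiding (sym)
open import Data.Bool using (Bool; true; false; not; _∨_; if_then_else_)
import Data.Bool.Properties as Bool
open import Data.Empty using (⊥-elim)
open import Data.Fin using (Fin; toℕ; fromℕ<; splitAt; join; _↑ˡ_; _↑ʳ_; combine; remQuot)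
  renaming (_≟_ to _≟ᶠ_)
open import Data.Fin.Properties using (toℕ-fromℕ<; splitAt-join; splitAt-↑ˡ; splitAt-↑ʳ; combine-remQuot)
open import Data.Fin.Subset.Properties using (anySubset?)
open import Data.List
  using (List; []; _∷_; [_]; length; map; _++_; concatMap; allFin; cartesianProduct; cartesianProductWith)
open import Data.List.Properties using (length-++; length-map; length-tabulate)
open import Data.List.Relation.Unary.All as All using (All; []; _∷_)
import Data.List.Relation.Unary.All.Properties as All
open import Data.List.Relation.Unary.Any as Any using (Any; here; there)
import Data.List.Relation.Unary.Any.Properties as Any
open import Data.List.Membership.Propositional using (_∈_; _∉_)
open import Data.List.Membership.Propositional.Properties
  using (∈-++⁺ˡ; ∈-++⁺ʳ; ∈-++⁻; ∈-map⁺; ∈-allFin; ∈-cartesianProduct⁺; ∈-cartesianProductWith⁺)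
open import Data.Nat
open import Data.Nat.DivMod using (_/_; m/n*n≤m; m*n/n≡m; /-monoˡ-≤)
open import Data.Nat.Induction using (<-wellFounded)
open import Data.Nat.Logarithm using (⌈log₂_⌉; ⌈log₂⌉-mono-≤; ⌈log₂2^n⌉≡n)
open import Data.Nat.Logarithm.Core using (⌈log2⌉)
open import Data.Nat.Properties
open import Data.Nat.Solver using (module +-*-Solver)
open import Data.Product using (Σ; _×_; _,_; proj₁; proj₂; ∃; uncurry)
import Data.Product as Product
open import Data.Sum using (_⊎_; inj₁; inj₂)
import Data.Sum as Sum
open import Data.Vec using (Vec; []; _∷_; lookup; tabulate)
open import Data.Vec.Properties using (lookup∘tabulate; tabulate-cong; tabulate∘lookup)
open import Function using (_∘_)
open import Induction.WellFounded using (Acc; acc)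
open import Relation.Binary.Definitions using (DecidableEquality)
open import Relation.Binary.PropositionalEquality
  using (_≡_; refl; sym; trans; cong; cong₂; subst; subst₂; module ≡-Reasoning)
open import Relation.Nullary using (Dec; yes; no; ¬_; does)
open import Relation.Nullary.Decidable using (isNo; map′)

private
  variable
    A B C V W : Set
    a b k m n L M N P S : ℕ

-- Enumerating k-CNFs of bounded size

length-cartesianProductWith : (f : A → B → C) (xs : List A) (ys : List B) →
  length (cartesianProductWith f xs ys) ≡ length xs * length ys
length-cartesianProductWith f [] ys = refl
length-cartesianProductWith f (x ∷ xs) ys = begin
  length (map (f x) ys ++ cartesianProductWith f xs ys)
    ≡⟨ length-++ (map (f x) ys) ⟩
  length (map (f x) ys) + length (cartesianProductWith f xs ys)
    ≡⟨ cong₂ _+_ (length-map (f x) ys) (length-cartesianProductWith f xs ys) ⟩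
  length ys + length xs * length ys ∎
  where open ≡-Reasoning

listsUpTo : List A → ℕ → List (List A)
listsUpTo xs zero    = [ [] ]
listsUpTo xs (suc k) = [] ∷ cartesianProductWith _∷_ xs (listsUpTo xs k)

length-listsUpTo : (xs : List A) (k : ℕ) → length (listsUpTo xs k) ≤ suc (length xs) ^ k
length-listsUpTo xs zero    = ≤-refl
length-listsUpTo xs (suc k) = begin
  suc (length (cartesianProductWith _∷_ xs (listsUpTo xs k)))
    ≡⟨ cong suc (length-cartesianProductWith _∷_ xs (listsUpTo xs k)) ⟩
  suc (length xs * length (listsUpTo xs k))
    ≤⟨ +-mono-≤ (m^n>0 (suc (length xs)) k) (*-monoʳ-≤ (length xs) (length-listsUpTo xs k)) ⟩
  suc (length xs) ^ suc k ∎
  where open ≤-Reasoning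

∈-listsUpTo : {xs ys : List A} → All (_∈ xs) ys → length ys ≤ k → ys ∈ listsUpTo xs k
∈-listsUpTo {k = zero}  []         _         = here refl
∈-listsUpTo {k = suc k} []         _         = here refl
∈-listsUpTo {k = suc k} (x∈ ∷ ys∈) (s≤s len) =
  there (∈-cartesianProductWith⁺ _∷_ x∈ (∈-listsUpTo ys∈ len))

encVars : (n M : ℕ) → List (EncVar n M)
encVars n M = map (splitAt n) (allFin (n + M))

∈-encVars : (x : EncVar n M) → x ∈ encVars n M
∈-encVars {n} {M} x = subst (_∈ encVars n M) (splitAt-join n M x) (∈-map⁺ (splitAt n) (∈-allFin (join n M x)))

length-encVars : (n M : ℕ) → length (encVars n M) ≡ n + M
length-encVars n M = trans (length-map (splitAt n) (allFin (n + M))) (length-tabulate _)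

literals : List V → List (Literal V)
literals vs = cartesianProduct vs (true ∷ false ∷ [])

∈-literals : {vs : List V} {x : V} (pol : Bool) → x ∈ vs → (x , pol) ∈ literals vs
∈-literals true  x∈ = ∈-cartesianProduct⁺ x∈ (here refl)
∈-literals false x∈ = ∈-cartesianProduct⁺ x∈ (there (here refl))

kCNFBound : (n M k S : ℕ) → ℕ
kCNFBound n M k S = suc (suc ((n + M) * 2) ^ k) ^ S

kCNFs : (n M k S : ℕ) → List (CNF (EncVar n M))
kCNFs n M k S = listsUpTo (listsUpTo (literals (encVars n M)) k) S

∈-kCNFs : {F : CNF (EncVar n M)} → IsKCNF k F → size F ≤ S → F ∈ kCNFs n M k S
∈-kCNFs kF F≤S =
  ∈-listsUpTo (All.map (∈-listsUpTo (All.tabulate λ {(x , pol)} _ → ∈-literals pol (∈-encVars x))) kF) F≤S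

length-kCNFs : (n M k S : ℕ) → length (kCNFs n M k S) ≤ kCNFBound n M k S
length-kCNFs n M k S = begin
  length (kCNFs n M k S)
    ≤⟨ length-listsUpTo _ S ⟩
  suc (length (listsUpTo lits k)) ^ S
    ≤⟨ ^-monoˡ-≤ S (s≤s (length-listsUpTo lits k)) ⟩
  suc (suc (length lits) ^ k) ^ S
    ≡⟨ cong (λ l → suc (suc l ^ k) ^ S) length-lits ⟩
  kCNFBound n M k S ∎
  where
  open ≤-Reasoning
  lits = literals (encVars n M)
  length-lits : length lits ≡ (n + M) * 2
  length-lits = trans (length-cartesianProductWith _,_ (encVars n M) _) (cong (_* 2) (length-encVars n M))

-- Deciding satisfiability

vars : CNF V → List V
vars = concatMap (map proj₁)

satisfies-agree : {α β : V → Bool} (F : CNF V) →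
  (∀ {x} → x ∈ vars F → α x ≡ β x) → Satisfies α F → Satisfies β F
satisfies-agree {V} {α} {β} [] agree [] = []
satisfies-agree {V} {α} {β} (C ∷ F) agree (satC ∷ satF) =
  clause-agree C (agree ∘ ∈-++⁺ˡ) satC ∷ satisfies-agree F (agree ∘ ∈-++⁺ʳ (map proj₁ C)) satF
  where
  clause-agree : (C : Clause V) → (∀ {x} → x ∈ map proj₁ C → α x ≡ β x) →
    Any (λ l → litVal α l ≡ true) C → Any (λ l → litVal β l ≡ true) C
  clause-agree ((x , pol) ∷ C) agree (here αl) =
    here (trans (cong (λ t → if pol then t else not t) (sym (agree (here refl)))) αl)
  clause-agree (_ ∷ C) agree (there αC) = there (clause-agree C (agree ∘ there) αC)

satisfies? : (α : V → Bool) (F : CNF V) → Dec (Satisfies α F)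
satisfies? α = All.all? (Any.any? (λ l → litVal α l Bool.≟ true))

satisfiable? : (F : CNF (Fin M)) → Dec (Satisfiable F)
satisfiable? F = map′
  (λ (s , sat) → lookup s , sat)
  (λ (α , sat) → tabulate α , satisfies-agree F (λ {x} _ → sym (lookup∘tabulate α x)) sat)
  (anySubset? (λ s → satisfies? (lookup s) F))

-- Renaming the auxiliary variables

rename : (V → W) → CNF V → CNF W
rename ρ = map (map (Product.map₁ ρ))

size-rename : (ρ : V → W) (F : CNF V) → size (rename ρ F) ≡ size F
size-rename ρ = length-map _

IsKCNF-rename : (ρ : V → W) {F : CNF V} → IsKCNF k F → IsKCNF k (rename ρ F)
IsKCNF-rename {k = k} ρ kF = All.map⁺ (All.map (λ {C} len → subst (_≤ k) (sym (length-map _ C)) len) kF)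

satisfies-rename⁺ : {β : W → Bool} (ρ : V → W) {F : CNF V} → Satisfies (β ∘ ρ) F → Satisfies β (rename ρ F)
satisfies-rename⁺ ρ sat = All.map⁺ (All.map Any.map⁺ sat)

satisfies-rename⁻ : {β : W → Bool} (ρ : V → W) {F : CNF V} → Satisfies β (rename ρ F) → Satisfies (β ∘ ρ) F
satisfies-rename⁻ ρ sat = All.map Any.map⁻ (All.map⁻ sat)

renameAux : (Fin m → Fin M) → CNF (EncVar n m) → CNF (EncVar n M)
renameAux ρ = rename (Sum.map₂ ρ)

clauseSatX-renameAux : (ρ : Fin m → Fin M) (τ : Fin n → Bool) (C : Clause (EncVar n m)) →
  clauseSatX τ (map (Product.map₁ (Sum.map₂ ρ)) C) ≡ clauseSatX τ C
clauseSatX-renameAux ρ τ []                    = refl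
clauseSatX-renameAux ρ τ ((inj₁ x , pol) ∷ C) = cong (litVal τ (x , pol) ∨_) (clauseSatX-renameAux ρ τ C)
clauseSatX-renameAux ρ τ ((inj₂ y , pol) ∷ C) = clauseSatX-renameAux ρ τ C

dropX-renameAux : (ρ : Fin m → Fin M) (C : Clause (EncVar n m)) →
  dropX (map (Product.map₁ (Sum.map₂ ρ)) C) ≡ map (Product.map₁ ρ) (dropX C)
dropX-renameAux ρ []                    = refl
dropX-renameAux ρ ((inj₁ x , pol) ∷ C) = dropX-renameAux ρ C
dropX-renameAux ρ ((inj₂ y , pol) ∷ C) = cong ((ρ y , pol) ∷_) (dropX-renameAux ρ C)

restrict-renameAux : (ρ : Fin m → Fin M) (τ : Fin n → Bool) (F : CNF (EncVar n m)) →
  restrict τ (renameAux ρ F) ≡ rename ρ (restrict τ F)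
restrict-renameAux ρ τ [] = refl
restrict-renameAux ρ τ (C ∷ F) rewrite clauseSatX-renameAux ρ τ C with clauseSatX τ C
... | true  = restrict-renameAux ρ τ F
... | false = cong₂ _∷_ (dropX-renameAux ρ C) (restrict-renameAux ρ τ F)

auxVars : CNF (EncVar n m) → List (Fin m)
auxVars F = vars (map dropX F)

∈-auxVars-restrict : (τ : Fin n → Bool) (F : CNF (EncVar n m)) {y : Fin m} →
  y ∈ vars (restrict τ F) → y ∈ auxVars F
∈-auxVars-restrict τ (C ∷ F) y∈ with clauseSatX τ C
... | true  = ∈-++⁺ʳ _ (∈-auxVars-restrict τ F y∈)
... | false with ∈-++⁻ (map proj₁ (dropX C)) y∈
...   | inj₁ y∈C = ∈-++⁺ˡ y∈C
...   | inj₂ y∈F = ∈-++⁺ʳ _ (∈-auxVars-restrict τ F y∈F)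

length-dropX : (C : Clause (EncVar n m)) → length (dropX C) ≤ length C
length-dropX []                  = z≤n
length-dropX ((inj₁ x , _) ∷ C) = m≤n⇒m≤1+n (length-dropX C)
length-dropX ((inj₂ y , _) ∷ C) = s≤s (length-dropX C)

length-auxVars : {F : CNF (EncVar n m)} → IsKCNF k F → length (auxVars F) ≤ k * size F
length-auxVars         {F = []}    []          = z≤n
length-auxVars {k = k} {F = C ∷ F} (lenC ∷ kF) = begin
  length (map proj₁ (dropX C) ++ auxVars F)
    ≡⟨ length-++ (map proj₁ (dropX C)) ⟩
  length (map proj₁ (dropX C)) + length (auxVars F)
    ≡⟨ cong (_+ length (auxVars F)) (length-map proj₁ (dropX C)) ⟩
  length (dropX C) + length (auxVars F)
    ≤⟨ +-mono-≤ (≤-trans (length-dropX C) lenC) (length-auxVars kF) ⟩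
  k + k * size F
    ≡⟨ *-suc k (size F) ⟨
  k * size (C ∷ F) ∎
  where open ≤-Reasoning

lookupOr : B → List B → ℕ → B
lookupOr d []       _       = d
lookupOr d (x ∷ xs) zero    = x
lookupOr d (x ∷ xs) (suc i) = lookupOr d xs i

-- Injectivity of ρ on ys, in the form used: every Boolean assignment of ys factors through ρ.
InjectiveOn : {A : Set} → (A → Fin M) → List A → Set
InjectiveOn {M} ρ ys = (α : _ → Bool) → Σ (Fin M → Bool) λ β → ∀ {y} → y ∈ ys → β (ρ y) ≡ α y

module _ {A : Set} (_≟_ : DecidableEquality A) where

  position : A → List A → ℕ
  position x []       = 0
  position x (y ∷ ys) with x ≟ y
  ... | yes _ = 0
  ... | no  _ = suc (position x ys)

  position≤length : (x : A) (ys : List A) → position x ys ≤ length ys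
  position≤length x []       = z≤n
  position≤length x (y ∷ ys) with x ≟ y
  ... | yes _ = z≤n
  ... | no  _ = s≤s (position≤length x ys)

  lookupOr-position : (d : B) (f : A → B) {x : A} {ys : List A} → x ∈ ys →
    lookupOr d (map f ys) (position x ys) ≡ f x
  lookupOr-position d f {x} {y ∷ ys} x∈ with x ≟ y
  ... | yes refl = refl
  ... | no  x≢y  = lookupOr-position d f (Any.tail x≢y x∈)

  -- ρ sends y to its position in ys, and β reads α back off that position.
  injectiveRenamingOn : (ys : List A) → length ys < M → Σ (A → Fin M) λ ρ → InjectiveOn ρ ys
  injectiveRenamingOn ys ys<M = ρ , λ α → (lookupOr false (map α ys) ∘ toℕ) , λ {y} y∈ → begin
    lookupOr false (map α ys) (toℕ (ρ y))   ≡⟨ cong (lookupOr false (map α ys)) (toℕ-fromℕ< _) ⟩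
    lookupOr false (map α ys) (position y ys) ≡⟨ lookupOr-position false α y∈ ⟩
    α y ∎
    where
    open ≡-Reasoning
    ρ : A → Fin _
    ρ y = fromℕ< (≤-<-trans (position≤length y ys) ys<M)

encodes-renameAux : {G : Graph n} {F : CNF (EncVar n m)} (ρ : Fin m → Fin M) →
  InjectiveOn ρ (auxVars F) → Encodes G F → Encodes G (renameAux ρ F)
encodes-renameAux {F = F} ρ extend enc τ = proj₁ (enc τ) ∘ back , forth ∘ proj₂ (enc τ)
  where
  back : Satisfiable (restrict τ (renameAux ρ F)) → Satisfiable (restrict τ F)
  back (β , sat) = β ∘ ρ , satisfies-rename⁻ ρ (subst (Satisfies β) (restrict-renameAux ρ τ F) sat)
  forth : Satisfiable (restrict τ F) → Satisfiable (restrict τ (renameAux ρ F))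
  forth (α , sat) = β , subst (Satisfies β) (sym (restrict-renameAux ρ τ F))
    (satisfies-rename⁺ ρ (satisfies-agree _ (λ y∈ → sym (β-extends (∈-auxVars-restrict τ F y∈))) sat))
    where
    β = proj₁ (extend α)
    β-extends = proj₂ (extend α)

smallEncoding : {G : Graph n} {F : CNF (EncVar n m)} → IsKCNF k F → size F ≤ S → Encodes G F →
  Σ (CNF (EncVar n (suc (k * S)))) λ F′ → IsKCNF k F′ × size F′ ≤ S × Encodes G F′
smallEncoding {k = k} {G = G} {F = F} kF F≤S enc =
  renameAux ρ F , IsKCNF-rename (Sum.map₂ ρ) kF , subst (_≤ _) (sym (size-rename (Sum.map₂ ρ) F)) F≤S ,
  encodes-renameAux {G = G} {F = F} ρ extend enc
  where
  aux<M = s≤s (≤-trans (length-auxVars kF) (*-monoʳ-≤ k F≤S))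
  ρ = proj₁ (injectiveRenamingOn _≟ᶠ_ (auxVars F) aux<M)
  extend = proj₂ (injectiveRenamingOn _≟ᶠ_ (auxVars F) aux<M)

-- An encoding determines its graph

pairIndicator : Fin n → Fin n → Fin n → Bool
pairIndicator u v x = does (x ≟ᶠ u) ∨ does (x ≟ᶠ v)

pairIndicator-true : (u v x : Fin n) → pairIndicator u v x ≡ true → x ≡ u ⊎ x ≡ v
pairIndicator-true u v x eq with x ≟ᶠ u | x ≟ᶠ v
... | yes x≡u | _       = inj₁ x≡u
... | no  _   | yes x≡v = inj₂ x≡v

pairIndicator-left : (u v : Fin n) → pairIndicator u v u ≡ true
pairIndicator-left u v with u ≟ᶠ u
... | yes _   = refl
... | no  u≢u = ⊥-elim (u≢u refl)

pairIndicator-right : (u v : Fin n) → pairIndicator u v v ≡ true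
pairIndicator-right u v with v ≟ᶠ v
... | yes _   = Bool.∨-zeroʳ _
... | no  v≢v = ⊥-elim (v≢v refl)

independent-pair⇒nonadjacent : (G : Graph n) (u v : Fin n) →
  IsIndependent G (pairIndicator u v) → Adj G u v ≡ false
independent-pair⇒nonadjacent G u v ind = ind u v (pairIndicator-left u v) (pairIndicator-right u v)

nonadjacent⇒independent-pair : (G : Graph n) (u v : Fin n) →
  Adj G u v ≡ false → IsIndependent G (pairIndicator u v)
nonadjacent⇒independent-pair G u v uv x y x∈ y∈ with pairIndicator-true u v x x∈ | pairIndicator-true u v y y∈
... | inj₁ refl | inj₁ refl = irrefl G u
... | inj₁ refl | inj₂ refl = uv
... | inj₂ refl | inj₁ refl = trans (Graph.sym G v u) uv
... | inj₂ refl | inj₂ refl = irrefl G v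

decodeAdj : CNF (EncVar n m) → Fin n → Fin n → Bool
decodeAdj F u v = isNo (satisfiable? (restrict (pairIndicator u v) F))

decodeAdj-correct : {G : Graph n} {F : CNF (EncVar n m)} → Encodes G F →
  (u v : Fin n) → decodeAdj F u v ≡ Adj G u v
decodeAdj-correct {G = G} {F} enc u v with satisfiable? (restrict (pairIndicator u v) F)
... | yes sat = sym (independent-pair⇒nonadjacent G u v (proj₁ (enc (pairIndicator u v)) sat))
... | no ¬sat with Adj G u v in uv
...   | true  = refl
...   | false = ⊥-elim (¬sat (proj₂ (enc (pairIndicator u v)) (nonadjacent⇒independent-pair G u v uv)))

crossing : (Fin a → Fin b → Bool) → Fin a ⊎ Fin b → Fin a ⊎ Fin b → Bool
crossing R (inj₁ i) (inj₂ j) = R i j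
crossing R (inj₂ j) (inj₁ i) = R i j
crossing R (inj₁ _) (inj₁ _) = false
crossing R (inj₂ _) (inj₂ _) = false

crossing-sym : (R : Fin a → Fin b → Bool) (x y : Fin a ⊎ Fin b) → crossing R x y ≡ crossing R y x
crossing-sym R (inj₁ _) (inj₁ _) = refl
crossing-sym R (inj₁ _) (inj₂ _) = refl
crossing-sym R (inj₂ _) (inj₁ _) = refl
crossing-sym R (inj₂ _) (inj₂ _) = refl

crossing-irrefl : (R : Fin a → Fin b → Bool) (x : Fin a ⊎ Fin b) → crossing R x x ≡ false
crossing-irrefl R (inj₁ _) = refl
crossing-irrefl R (inj₂ _) = refl

bipartite : (Fin a → Fin b → Bool) → Graph (a + b)
bipartite {a} R = record
  { Adj    = λ u v → crossing R (splitAt a u) (splitAt a v)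
  ; sym    = λ u v → crossing-sym R (splitAt a u) (splitAt a v)
  ; irrefl = λ v → crossing-irrefl R (splitAt a v)
  }

Adj-bipartite : (R : Fin a → Fin b → Bool) (i : Fin a) (j : Fin b) →
  Adj (bipartite R) (i ↑ˡ b) (a ↑ʳ j) ≡ R i j
Adj-bipartite {a} {b} R i j = cong₂ (crossing R) (splitAt-↑ˡ a i b) (splitAt-↑ʳ a b j)

bitGraph : (a b : ℕ) → Vec Bool (a * b) → Graph (a + b)
bitGraph a b bits = bipartite {a} {b} (λ i j → lookup bits (combine i j))

decodeBits : (a b : ℕ) → CNF (EncVar (a + b) m) → Vec Bool (a * b)
decodeBits a b F = tabulate (uncurry (λ i j → decodeAdj F (i ↑ˡ b) (a ↑ʳ j)) ∘ remQuot {a} b)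

decodeBits-correct : (bits : Vec Bool (a * b)) {F : CNF (EncVar (a + b) m)} →
  Encodes (bitGraph a b bits) F → decodeBits a b F ≡ bits
decodeBits-correct {a} {b} bits {F} enc = trans (tabulate-cong decoded) (tabulate∘lookup bits)
  where
  decoded : (ix : Fin (a * b)) → uncurry (λ i j → decodeAdj F (i ↑ˡ b) (a ↑ʳ j)) (remQuot b ix) ≡ lookup bits ix
  decoded ix = let (i , j) = remQuot {a} b ix in begin
    decodeAdj F (i ↑ˡ b) (a ↑ʳ j)
      ≡⟨ decodeAdj-correct {G = bitGraph a b bits} {F} enc (i ↑ˡ b) (a ↑ʳ j) ⟩
    Adj (bitGraph a b bits) (i ↑ˡ b) (a ↑ʳ j) ≡⟨ Adj-bipartite {a} {b} _ i j ⟩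
    lookup bits (combine i j)                 ≡⟨ cong (lookup bits) (combine-remQuot {a} b ix) ⟩
    lookup bits ix ∎
    where open ≡-Reasoning

withHead : Bool → List (Vec Bool (suc N)) → List (Vec Bool N)
withHead _     []                  = []
withHead true  ((true  ∷ v) ∷ vs) = v ∷ withHead true vs
withHead true  ((false ∷ _) ∷ vs) = withHead true vs
withHead false ((true  ∷ _) ∷ vs) = withHead false vs
withHead false ((false ∷ v) ∷ vs) = v ∷ withHead false vs

∈-withHead : (c : Bool) {v : Vec Bool N} {vs : List (Vec Bool (suc N))} → (c ∷ v) ∈ vs → v ∈ withHead c vs
∈-withHead true  {vs = (true  ∷ _) ∷ _} (here refl) = here refl
∈-withHead false {vs = (false ∷ _) ∷ _} (here refl) = here refl
∈-withHead true  {vs = (true  ∷ _) ∷ _} (there v∈) = there (∈-withHead true v∈)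
∈-withHead true  {vs = (false ∷ _) ∷ _} (there v∈) = ∈-withHead true v∈
∈-withHead false {vs = (true  ∷ _) ∷ _} (there v∈) = ∈-withHead false v∈
∈-withHead false {vs = (false ∷ _) ∷ _} (there v∈) = there (∈-withHead false v∈)

length-withHead : (vs : List (Vec Bool (suc N))) →
  length (withHead true vs) + length (withHead false vs) ≡ length vs
length-withHead []                 = refl
length-withHead ((true  ∷ _) ∷ vs) = cong suc (length-withHead vs)
length-withHead ((false ∷ _) ∷ vs) = trans (+-suc _ _) (cong suc (length-withHead vs))

missingVector : (vs : List (Vec Bool N)) → length vs < 2 ^ N → ∃ λ v → v ∉ vs
missingVector {zero}  []      _ = [] , λ ()
missingVector {zero}  (_ ∷ _) (s≤s ())
missingVector {suc N} vs short with length (withHead true vs) <? 2 ^ N | length (withHead false vs) <? 2 ^ N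
... | yes shortT | _ = Product.map (true ∷_) (λ v∉ → v∉ ∘ ∈-withHead true) (missingVector _ shortT)
... | no  _      | yes shortF = Product.map (false ∷_) (λ v∉ → v∉ ∘ ∈-withHead false) (missingVector _ shortF)
... | no  longT  | no longF = ⊥-elim (<⇒≱ short (begin
  2 ^ suc N                                               ≡⟨ cong (2 ^ N +_) (+-identityʳ (2 ^ N)) ⟩
  2 ^ N + 2 ^ N                                           ≤⟨ +-mono-≤ (≮⇒≥ longT) (≮⇒≥ longF) ⟩
  length (withHead true vs) + length (withHead false vs) ≡⟨ length-withHead vs ⟩
  length vs ∎))
  where open ≤-Reasoning

unencodableBitGraph : (a b : ℕ) (Fs : List (CNF (EncVar (a + b) M))) → length Fs < 2 ^ (a * b) →
  ∃ λ bits → ∀ {F} → F ∈ Fs → ¬ Encodes (bitGraph a b bits) F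
unencodableBitGraph a b Fs short
  with missingVector (map (decodeBits a b) Fs) (subst (_< _) (sym (length-map _ Fs)) short)
... | bits , bits∉ = bits , λ {F} F∈ enc → bits∉ (subst (_∈ map (decodeBits a b) Fs)
  (decodeBits-correct {a = a} {b = b} bits {F = F} enc) (∈-map⁺ (decodeBits a b) F∈))

EveryKCNFEncodingExceeds : ℕ → ℕ → Graph n → Set
EveryKCNFEncodingExceeds {n} k S G = ∀ m (F : CNF (EncVar n m)) → IsKCNF k F → Encodes G F → S < size F

bitGraphWithoutSmallEncoding : (a b : ℕ) → kCNFBound (a + b) (suc (k * S)) k S < 2 ^ (a * b) →
  Σ (Graph (a + b)) (EveryKCNFEncodingExceeds k S)
bitGraphWithoutSmallEncoding {k} {S} a b count<
  with unencodableBitGraph a b _ (≤-<-trans (length-kCNFs (a + b) _ k S) count<)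
... | bits , unencodable = bitGraph a b bits , λ m F kF enc → ≰⇒> λ F≤S →
  let (F′ , kF′ , F′≤S , enc′) = smallEncoding {G = bitGraph a b bits} {F = F} kF F≤S enc
  in unencodable (∈-kCNFs kF′ F′≤S) enc′

n≤2^⌈log₂n⌉ : (n : ℕ) → n ≤ 2 ^ ⌈log₂ n ⌉
n≤2^⌈log₂n⌉ n = bound n (<-wellFounded n)
  where
  bound : (n : ℕ) (acc : Acc _<_ n) → n ≤ 2 ^ ⌈log2⌉ n acc
  bound 0             _        = z≤n
  bound 1             _        = s≤s z≤n
  bound (suc (suc n)) (acc rs) = begin
    2 + n                        ≡⟨ cong (2 +_) (⌊n/2⌋+⌈n/2⌉≡n n) ⟨
    2 + (⌊ n /2⌋ + ⌈ n /2⌉)      ≤⟨ +-monoʳ-≤ 2 (+-monoˡ-≤ ⌈ n /2⌉ (⌊n/2⌋≤⌈n/2⌉ n)) ⟩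
    2 + (⌈ n /2⌉ + ⌈ n /2⌉)      ≡⟨ cong suc (+-suc ⌈ n /2⌉ ⌈ n /2⌉) ⟨
    suc ⌈ n /2⌉ + suc ⌈ n /2⌉    ≡⟨ cong (suc ⌈ n /2⌉ +_) (+-identityʳ _) ⟨
    2 * suc ⌈ n /2⌉              ≤⟨ *-monoʳ-≤ 2 (bound (suc ⌈ n /2⌉) (rs (⌈n/2⌉<n n))) ⟩
    2 * 2 ^ ⌈log2⌉ (suc ⌈ n /2⌉) (rs (⌈n/2⌉<n n)) ∎
    where open ≤-Reasoning

1≤⌈log₂n⌉ : 2 ≤ n → 1 ≤ ⌈log₂ n ⌉
1≤⌈log₂n⌉ {n} 2≤n = subst (_≤ ⌈log₂ n ⌉) (⌈log₂2^n⌉≡n 1) (⌈log₂⌉-mono-≤ 2≤n)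

cube-bound : 4 ≤ P → suc ((P + suc (P * P)) * 2) ≤ P ^ 3
cube-bound {P} 4≤P = subst (λ P → suc ((P + suc (P * P)) * 2) ≤ P ^ 3) (m+[n∸m]≡n 4≤P) (bound (P ∸ 4))
  where
  bound : (t : ℕ) → suc ((4 + t + suc ((4 + t) * (4 + t))) * 2) ≤ (4 + t) ^ 3
  bound t = subst (suc ((4 + t + suc ((4 + t) * (4 + t))) * 2) ≤_) (sym (expand t)) (m≤m+n _ _)
    where
    open +-*-Solver
    expand : (t : ℕ) → (4 + t) ^ 3 ≡
      suc ((4 + t + suc ((4 + t) * (4 + t))) * 2) + (21 + 30 * t + 10 * (t * t) + t * t * t)
    expand = solve 1 (λ t → (con 4 :+ t) :^ 3 :=
      con 1 :+ (con 4 :+ t :+ (con 1 :+ (con 4 :+ t) :* (con 4 :+ t))) :* con 2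
        :+ (con 21 :+ con 30 :* t :+ con 10 :* (t :* t) :+ t :* t :* t)) refl

m/n<o⇒m<o*n : ∀ {m n o} .{{_ : NonZero n}} → m / n < o → m < o * n
m/n<o⇒m<o*n {m} {n} {o} m/n<o =
  ≰⇒> λ o*n≤m → <⇒≱ m/n<o (subst (_≤ m / n) (m*n/n≡m o n) (/-monoˡ-≤ n o*n≤m))

n<4*⌊n/2⌋ : (n : ℕ) → 2 ≤ n → n < 4 * ⌊ n /2⌋
n<4*⌊n/2⌋ 0 ()
n<4*⌊n/2⌋ 1 (s≤s ())
n<4*⌊n/2⌋ 2 _ = s≤s (s≤s (s≤s z≤n))
n<4*⌊n/2⌋ 3 _ = ≤-refl
n<4*⌊n/2⌋ (suc (suc n@(suc (suc _)))) _ = begin-strict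
  2 + n               <⟨ +-monoʳ-< 2 (n<4*⌊n/2⌋ n (s≤s (s≤s z≤n))) ⟩
  2 + 4 * ⌊ n /2⌋     ≤⟨ +-monoˡ-≤ (4 * ⌊ n /2⌋) (s≤s (s≤s (z≤n {2}))) ⟩
  4 + 4 * ⌊ n /2⌋     ≡⟨ *-suc 4 ⌊ n /2⌋ ⟨
  4 * suc ⌊ n /2⌋     ∎
  where open ≤-Reasoning

-- Chosen so that 16 · L(3k + 1)S = S · γ k · L, see exponent<.
γ : ℕ → ℕ
γ k = 16 * suc (3 * k)

k≤γ : (k : ℕ) → k ≤ γ k
k≤γ k = ≤-trans (≤-trans (m≤m+n k _) (n≤1+n _)) (m≤n*m (suc (3 * k)) 16)

kCNFBound≤ : 4 ≤ P → n ≤ P → k * S ≤ P * P → kCNFBound n (suc (k * S)) k S ≤ P ^ (suc (3 * k) * S)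
kCNFBound≤ {P} {n} {k} {S} 4≤P n≤P kS≤P² = begin
  suc (suc ((n + suc (k * S)) * 2) ^ k) ^ S ≤⟨ ^-monoˡ-≤ S (s≤s (^-monoˡ-≤ k literals≤P³)) ⟩
  suc ((P ^ 3) ^ k) ^ S                     ≡⟨ cong (λ e → suc e ^ S) (^-*-assoc P 3 k) ⟩
  suc (P ^ (3 * k)) ^ S                     ≤⟨ ^-monoˡ-≤ S (m<m*n (P ^ (3 * k)) P (≤-trans (s≤s (s≤s z≤n)) 4≤P)) ⟩
  (P ^ (3 * k) * P) ^ S                     ≡⟨ cong (_^ S) (*-comm (P ^ (3 * k)) P) ⟩
  (P ^ suc (3 * k)) ^ S                     ≡⟨ ^-*-assoc P (suc (3 * k)) S ⟩
  P ^ (suc (3 * k) * S)                     ∎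
  where
  open ≤-Reasoning
  instance
    P≢0 : NonZero P
    P≢0 = >-nonZero (≤-trans (s≤s z≤n) 4≤P)
    P^3k≢0 : NonZero (P ^ (3 * k))
    P^3k≢0 = m^n≢0 P (3 * k)
  literals≤P³ : suc ((n + suc (k * S)) * 2) ≤ P ^ 3
  literals≤P³ = ≤-trans (s≤s (*-monoˡ-≤ 2 (+-mono-≤ n≤P (s≤s kS≤P²)))) (cube-bound 4≤P)

exponent< : S * (γ k * L) ≤ n * n → n < 4 * a → n < 4 * b → L * (suc (3 * k) * S) < a * b
exponent< {S} {k} {L} {n} {a} {b} SγL≤n² n<4a n<4b = *-cancelˡ-< 16 _ _ (begin-strict
  16 * (L * (suc (3 * k) * S)) ≡⟨ rearrangeˡ L k S ⟩
  S * (γ k * L)                ≤⟨ SγL≤n² ⟩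
  n * n                        <⟨ *-mono-< n<4a n<4b ⟩
  4 * a * (4 * b)              ≡⟨ rearrangeʳ a b ⟩
  16 * (a * b)                 ∎)
  where
  open ≤-Reasoning
  open +-*-Solver
  rearrangeˡ : (L k S : ℕ) → 16 * (L * (suc (3 * k) * S)) ≡ S * (γ k * L)
  rearrangeˡ = solve 3 (λ L k S →
    con 16 :* (L :* ((con 1 :+ con 3 :* k) :* S)) := S :* (con 16 :* (con 1 :+ con 3 :* k) :* L)) refl
  rearrangeʳ : (a b : ℕ) → 4 * a * (4 * b) ≡ 16 * (a * b)
  rearrangeʳ = solve 2 (λ a b → con 4 :* a :* (con 4 :* b) := con 16 :* (a :* b)) refl

kCNFBound<2^ : 4 ≤ n → n ≤ 2 ^ L → 1 ≤ L → S * (γ k * L) ≤ n * n → n < 4 * a → n < 4 * b →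
  kCNFBound n (suc (k * S)) k S < 2 ^ (a * b)
kCNFBound<2^ {n} {L} {S} {k} {a} {b} 4≤n n≤2^L 1≤L SγL≤n² n<4a n<4b = begin-strict
  kCNFBound n (suc (k * S)) k S
    ≤⟨ kCNFBound≤ {k = k} {S = S} (≤-trans 4≤n n≤2^L) n≤2^L kS≤P² ⟩
  (2 ^ L) ^ (suc (3 * k) * S)
    ≡⟨ ^-*-assoc 2 L _ ⟩
  2 ^ (L * (suc (3 * k) * S))
    <⟨ ^-monoʳ-< 2 (s≤s (s≤s z≤n)) (exponent< {S = S} {k = k} {L = L} {a = a} {b = b} SγL≤n² n<4a n<4b) ⟩
  2 ^ (a * b) ∎
  where
  open ≤-Reasoning
  kS≤P² : k * S ≤ 2 ^ L * 2 ^ L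
  kS≤P² = begin
    k * S         ≤⟨ *-monoˡ-≤ S (≤-trans (k≤γ k) (m≤m*n (γ k) L {{>-nonZero 1≤L}})) ⟩
    γ k * L * S   ≡⟨ *-comm (γ k * L) S ⟩
    S * (γ k * L) ≤⟨ ≤-trans SγL≤n² (*-mono-≤ n≤2^L n≤2^L) ⟩
    2 ^ L * 2 ^ L ∎

graphWithoutSmallEncoding : 4 ≤ n → S * (γ k * ⌈log₂ n ⌉) ≤ n * n →
  Σ (Graph n) (EveryKCNFEncodingExceeds k S)
graphWithoutSmallEncoding {n} {S} {k} 4≤n SγL≤n² =
  subst (λ N → Σ (Graph N) (EveryKCNFEncodingExceeds k S)) (⌊n/2⌋+⌈n/2⌉≡n n)
    (bitGraphWithoutSmallEncoding lo hi count<)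
  where
  lo = ⌊ n /2⌋
  hi = ⌈ n /2⌉
  n<4lo : n < 4 * lo
  n<4lo = n<4*⌊n/2⌋ n (≤-trans (s≤s (s≤s z≤n)) 4≤n)
  count< : kCNFBound (lo + hi) (suc (k * S)) k S < 2 ^ (lo * hi)
  count< rewrite ⌊n/2⌋+⌈n/2⌉≡n n =
    kCNFBound<2^ {S = S} {k = k} {a = lo} {b = hi}
      4≤n (n≤2^⌈log₂n⌉ n) (1≤⌈log₂n⌉ (≤-trans (s≤s (s≤s z≤n)) 4≤n)) SγL≤n² n<4lo
      (<-≤-trans n<4lo (*-monoʳ-≤ 4 (⌊n/2⌋≤⌈n/2⌉ n)))

kCNFEncodingLowerBound : 4 ≤ n → Σ (Graph n) λ G →
  (m : ℕ) (F : CNF (EncVar n m)) → IsKCNF k F → Encodes G F → n * n < size F * (γ k * ⌈log₂ n ⌉)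
kCNFEncodingLowerBound {n} {k} 4≤n =
  Product.map₂ (λ exceeds m F kF enc → m/n<o⇒m<o*n (exceeds m F kF enc))
    (graphWithoutSmallEncoding 4≤n (m/n*n≤m (n * n) (γ k * ⌈log₂ n ⌉)))
  where
  instance
    γL≢0 : NonZero (γ k * ⌈log₂ n ⌉)
    γL≢0 = >-nonZero (≤-trans (1≤⌈log₂n⌉ (≤-trans (s≤s (s≤s z≤n)) 4≤n)) (m≤n*m ⌈log₂ n ⌉ (γ k)))

proposition16 : (k : ℕ) → 2 ≤ k →
    Σ ℕ (λ p → Σ ℕ (λ q → 1 ≤ p × 1 ≤ q × Σ ℕ (λ n₀ →
      (n : ℕ) → n₀ ≤ n → Σ (Graph n) (λ G →
        (m : ℕ) (F : CNF (EncVar n m)) → IsKCNF k F → Encodes G F →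
          p * (n * n) ≤ q * (size F * ⌈log₂ n ⌉)))))
-- The counting argument works for every k.
proposition16 k _ = 1 , γ k , s≤s z≤n , s≤s z≤n , 4 , λ n 4≤n →
  Product.map₂ (λ bound m F kF enc → rearrange n (size F) (bound m F kF enc)) (kCNFEncodingLowerBound 4≤n)
  where
  rearrange : ∀ n s → n * n < s * (γ k * ⌈log₂ n ⌉) → 1 * (n * n) ≤ γ k * (s * ⌈log₂ n ⌉)
  rearrange n s n²< = subst₂ _≤_ (sym (*-identityˡ (n * n))) (*-rearrange s (γ k) ⌈log₂ n ⌉) (<⇒≤ n²<)
    where
    open +-*-Solver
    *-rearrange : (s c L : ℕ) → s * (c * L) ≡ c * (s * L)
    *-rearrange = solve 3 (λ s c L → s :* (c :* L) := c :* (s :* L)) refl
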